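{- Let $n,k$ be positive integers with $n\ge 2k$ and $\gcd(n,k)=1$, and let $a,b$ be the smallest positive integers with $ak=bn-1$. Then for every vertex $U\in V(Q(n,k))$, the graph $Q(n,k)\setminus\{U\}$ is homomorphically equivalent to $Q(a,b)$, i.e. there are graph homomorphisms $Q(n,k)\setminus\{U\}\to Q(a,b)$ and $Q(a,b)\to Q(n,k)\setminus\{U\}$.
   Context: For a positive integer $n$ let $[n]=\{1,\dots,n\}$ and let $C_n$ be the cycle on $[n]$ with edges $\{i,i+1\}$ ($1\le i\le n-1$) and $\{n,1\}$. The Schrijver graph $\mathrm{SG}(n,k)$ ($n\ge 2k$) has as vertices the $k$-subsets of $[n]$ containing no two cyclically consecutive elements, two vertices adjacent iff they are disjoint. An arc of $C_n$ is a set $\{i,i+1,\dots,i+m-1\}$ (addition mod $n$) with $1\le m\le n-1$. A set $U\subseteq[n]$ is well-spread if for any two arcs $A,B$ with $|A|=|B|$ we have $\big||A\cap U|-|B\cap U|\big|\le 1$. $Q(n,k)$ is the induced subgraph of $\mathrm{SG}(n,k)$ on all well-spread $k$-subsets of $[n]$. A homomorphism $G\to H$ is a map $V(G)\to V(H)$ sending edges to edges. -}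

module Defs where

open import Data.Nat using (ℕ; zero; suc; _+_; _∸_; _≤_; _<ᵇ_)
open import Data.Bool using (Bool; true; false; if_then_else_)
open import Data.Fin using (Fin; toℕ)
open import Data.Fin.Subset using (Subset; _∈_; ∣_∣)
open import Data.Vec using ([]; _∷_)
open import Data.Product using (Σ; _×_; proj₁)
open import Relation.Nullary using (¬_)
open import Relation.Binary.PropositionalEquality using (_≡_; _≢_)

-- The ground set [n] is modelled by Fin n (element i+1 of the paper is index i).
-- Membership of a natural-number index in a subset (indices ≥ n are absent).
memℕ : ∀ {n} → Subset n → ℕ → Bool
memℕ [] _ = false
memℕ (b ∷ U) zero = b
memℕ (b ∷ U) (suc x) = memℕ U x

arcElem : ℕ → ℕ → ℕ → ℕ
arcElem n i j = if (i + j) <ᵇ n then i + j else (i + j) ∸ n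

arcCount : ∀ {n} → Subset n → ℕ → ℕ → ℕ
arcCount {n} U i zero = 0
arcCount {n} U i (suc m) =
  arcCount U i m + (if memℕ U (arcElem n i m) then 1 else 0)

NoConsecutive : ∀ {n} → Subset n → Set
NoConsecutive {n} U = (i : Fin n) →
  toℕ i ≢ arcElem n (toℕ i) 1 →
  ¬ (memℕ U (toℕ i) ≡ true × memℕ U (arcElem n (toℕ i) 1) ≡ true)

WellSpread : ∀ {n} → Subset n → Set
WellSpread {n} U = (i j : Fin n) (m : ℕ) → 1 ≤ m → m ≤ n ∸ 1 →
  arcCount U (toℕ i) m ≤ arcCount U (toℕ j) m + 1

IsQVertex : (n k : ℕ) → Subset n → Set
IsQVertex n k U = (∣ U ∣ ≡ k) × NoConsecutive U × WellSpread U

QVertex : (n k : ℕ) → Set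
QVertex n k = Σ (Subset n) (IsQVertex n k)

QAdj : ∀ {n k} → QVertex n k → QVertex n k → Set
QAdj {n} V W = (x : Fin n) → ¬ (x ∈ proj₁ V × x ∈ proj₁ W)

QMinus : (n k : ℕ) → Subset n → Set
QMinus n k U = Σ (QVertex n k) (λ V → proj₁ V ≢ U)

HomMinusToQ : (n k : ℕ) → Subset n → (a b : ℕ) → Set
HomMinusToQ n k U a b = Σ (QMinus n k U → QVertex a b) λ f →
  (V W : QMinus n k U) → QAdj (proj₁ V) (proj₁ W) → QAdj (f V) (f W)

HomQToMinus : (a b : ℕ) → (n k : ℕ) → Subset n → Set
HomQToMinus a b n k U = Σ (QVertex a b → QMinus n k U) λ g →
  (V W : QVertex a b) → QAdj V W → QAdj (proj₁ (g V)) (proj₁ (g W))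

-- When k is invertible modulo n, the well-spread k-subsets of [n] are exactly the n rotations
-- C_r = { t : (t k + r) mod n ≥ n − k } of the evenly spread set; the rotation r is recovered
-- from the maximum of the discrepancy n·|V ∩ [0, t)| − t·k, which oscillates by less than n.
-- Two rotations C_r, C_r′ are disjoint iff r′ − r mod n lies in [k, n − k], so Q(n,k) is the
-- circular clique K_{n/k} on ℤ/n.  Removing the vertex U = C_{r₀}, the maps x ↦ ⌊(x − r₀) a / n⌋
-- from (ℤ/n) ∖ {r₀} to ℤ/a and s ↦ r₀ + 1 + ⌊s n / a⌋ back are homomorphisms of circular
-- cliques: a k + 1 = b n makes these floors grow by at least b, resp. k, over steps of length at
-- least k, resp. b, and the periodicity of the floors turns the lower bounds into upper ones.
module Submission where

open import Defs
open import Data.Nat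
open import Data.Nat.Properties
open import Data.Nat.DivMod
open import Data.Nat.Divisibility using (_∣_; divides; ∣m+n∣m⇒∣n; ∣⇒≤; ∣m⇒∣m*n; n∣m*n; m%n≡0⇒n∣m; n∣m⇒m%n≡0)
open import Data.Nat.GCD using (gcd)
open import Data.Nat.Tactic.RingSolver using (solve-∀)
open import Data.Bool using (Bool; true; false; if_then_else_; T)
open import Data.Bool.Properties using (T-≡)
open import Data.Product using (Σ; _×_; _,_; proj₁; proj₂)
open import Data.Sum using (_⊎_; inj₁; inj₂)
open import Data.Unit using (⊤; tt)
open import Data.Fin using (Fin; toℕ; zero; suc; fromℕ<)
open import Data.Fin.Properties using (toℕ<n; toℕ-fromℕ<)
open import Data.Fin.Subset using (Subset; _∈_; ∣_∣)
open import Data.Vec using ([]; _∷_; tabulate)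
open import Data.Vec.Properties using (lookup∘tabulate; []=⇒lookup; lookup⇒[]=)
open import Function using (_∘_)
open import Function.Bundles using (Equivalence)
open import Relation.Nullary using (¬_; Dec; yes; no; contradiction)
open import Relation.Nullary.Reflects using (ofʸ; ofⁿ)
open import Relation.Binary.PropositionalEquality
open import Relation.Binary.Definitions using (tri<; tri≈; tri>)

indicator : Bool → ℕ
indicator b = if b then 1 else 0

indicator-injective : ∀ {b c} → indicator b ≡ indicator c → b ≡ c
indicator-injective {true}  {true}  _ = refl
indicator-injective {false} {false} _ = refl
indicator-injective {true}  {false} ()
indicator-injective {false} {true}  ()

record IsQuotient (n x c : ℕ) : Set where
  constructor bounds
  field
    lower : n * c ≤ x
    upper : x < n * c + n

quotient-maximal : ∀ {n x c c′} → IsQuotient n x c → n * c′ ≤ x → c′ ≤ c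
quotient-maximal {n} {x} {c} {c′} (bounds _ x<) nc′≤x = ≤-pred (*-cancelˡ-< n c′ (suc c)
  (≤-<-trans nc′≤x (subst (x <_) (trans (+-comm (n * c) n) (sym (*-suc n c))) x<)))

isQuotient-unique : ∀ {n x c c′} → IsQuotient n x c → IsQuotient n x c′ → c ≡ c′
isQuotient-unique q q′ =
  ≤-antisym (quotient-maximal q′ (IsQuotient.lower q)) (quotient-maximal q (IsQuotient.lower q′))

decomposition⇒isQuotient : ∀ {n x c ρ} → ρ < n → x ≡ ρ + n * c → IsQuotient n x c
decomposition⇒isQuotient {n} {c = c} {ρ} ρ<n refl = bounds
  (m≤n+m (n * c) ρ) (subst (_< n * c + n) (+-comm (n * c) ρ) (+-monoʳ-< (n * c) ρ<n))

isQuotient⇒decomposition : ∀ {n x c} → IsQuotient n x c → Σ ℕ λ ρ → ρ < n × x ≡ ρ + n * c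
isQuotient⇒decomposition {n} {x} {c} (bounds nc≤x x<) =
  x ∸ n * c , +-cancelˡ-< (n * c) _ n (subst (_< n * c + n) (sym (m+[n∸m]≡n nc≤x)) x<) ,
  sym (trans (+-comm (x ∸ n * c) (n * c)) (m+[n∸m]≡n nc≤x))

decomposition⇒% : ∀ {n} .{{_ : NonZero n}} {x c ρ} → ρ < n → x ≡ ρ + n * c → x % n ≡ ρ
decomposition⇒% {n} {c = c} {ρ} ρ<n refl = begin
  (ρ + n * c) % n ≡⟨ cong (λ z → (ρ + z) % n) (*-comm n c) ⟩
  (ρ + c * n) % n ≡⟨ [m+kn]%n≡m%n ρ c n ⟩
  ρ % n           ≡⟨ m<n⇒m%n≡m ρ<n ⟩
  ρ               ∎
  where open ≡-Reasoning

m%n≡m∸n : ∀ {m n} .{{_ : NonZero n}} → n ≤ m → m < n + n → m % n ≡ m ∸ n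
m%n≡m∸n {m} {n} n≤m m<2n = decomposition⇒% (m<n+o⇒m∸n<o m n m<2n)
  (trans (sym (m∸n+n≡m n≤m)) (cong (m ∸ n +_) (sym (*-identityʳ n))))

quotient-step : ∀ {n k x c} .{{_ : NonZero n}} → k ≤ n → IsQuotient n x c →
  IsQuotient n (x + k) (c + indicator (n ∸ k ≤ᵇ x % n))
quotient-step {n} {k} {x} {c} k≤n q with isQuotient⇒decomposition q
... | ρ , ρ<n , x≡ rewrite decomposition⇒% ρ<n x≡ with n ∸ k ≤ᵇ ρ | ≤ᵇ-reflects-≤ (n ∸ k) ρ
... | true | ofʸ n∸k≤ρ = decomposition⇒isQuotient (m<n+o⇒m∸n<o (ρ + k) n (+-mono-<-≤ ρ<n k≤n)) (begin
  x + k                  ≡⟨ cong (_+ k) x≡ ⟩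
  ρ + n * c + k          ≡⟨ +-comm-middle ρ (n * c) k ⟩
  ρ + k + n * c          ≡⟨ cong (_+ n * c) (sym (m∸n+n≡m n≤ρ+k)) ⟩
  ρ + k ∸ n + n + n * c  ≡⟨ +-collect (ρ + k ∸ n) n c ⟩
  ρ + k ∸ n + n * (c + 1) ∎)
  where
    open ≡-Reasoning
    n≤ρ+k : n ≤ ρ + k
    n≤ρ+k = subst (_≤ ρ + k) (m∸n+n≡m k≤n) (+-monoˡ-≤ k n∸k≤ρ)
    +-comm-middle : ∀ a b c → a + b + c ≡ a + c + b
    +-comm-middle = solve-∀
    +-collect : ∀ a n c → a + n + n * c ≡ a + n * (c + 1)
    +-collect = solve-∀
... | false | ofⁿ n∸k≰ρ = decomposition⇒isQuotient ρ+k<n (trans (cong (_+ k) x≡) (regroup ρ n c k))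
  where
    ρ+k<n : ρ + k < n
    ρ+k<n = subst (ρ + k <_) (m∸n+n≡m k≤n) (+-monoˡ-< k (≰⇒> n∸k≰ρ))
    regroup : ∀ a n c k → a + n * c + k ≡ a + k + n * (c + 0)
    regroup = solve-∀

[m%n+o]%n≡[m+o]%n : ∀ m o n .{{_ : NonZero n}} → (m % n + o) % n ≡ (m + o) % n
[m%n+o]%n≡[m+o]%n m o n = begin
  (m % n + o) % n         ≡⟨ %-distribˡ-+ (m % n) o n ⟩
  (m % n % n + o % n) % n ≡⟨ cong (λ z → (z + o % n) % n) (m%n%n≡m%n m n) ⟩
  (m % n + o % n) % n     ≡⟨ sym (%-distribˡ-+ m o n) ⟩
  (m + o) % n             ∎
  where open ≡-Reasoning

[m+o%n]%n≡[m+o]%n : ∀ m o n .{{_ : NonZero n}} → (m + o % n) % n ≡ (m + o) % n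
[m+o%n]%n≡[m+o]%n m o n = begin
  (m + o % n) % n ≡⟨ cong (_% n) (+-comm m (o % n)) ⟩
  (o % n + m) % n ≡⟨ [m%n+o]%n≡[m+o]%n o m n ⟩
  (o + m) % n     ≡⟨ cong (_% n) (+-comm o m) ⟩
  (m + o) % n     ∎
  where open ≡-Reasoning

[[m+p]%n+q]%n≡m%n : ∀ m {p q n} .{{_ : NonZero n}} → p + q ≡ n → ((m + p) % n + q) % n ≡ m % n
[[m+p]%n+q]%n≡m%n m {p} {q} {n} p+q≡n = begin
  ((m + p) % n + q) % n ≡⟨ [m%n+o]%n≡[m+o]%n (m + p) q n ⟩
  (m + p + q) % n       ≡⟨ cong (_% n) (trans (+-assoc m p q) (cong (m +_) p+q≡n)) ⟩
  (m + n) % n           ≡⟨ [m+n]%n≡m%n m n ⟩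
  m % n                 ∎
  where open ≡-Reasoning

[m%n*o+p]%n≡[m*o+p]%n : ∀ m o p n .{{_ : NonZero n}} → (m % n * o + p) % n ≡ (m * o + p) % n
[m%n*o+p]%n≡[m*o+p]%n m o p n = begin
  (m % n * o + p) % n       ≡⟨ sym ([m%n+o]%n≡[m+o]%n (m % n * o) p n) ⟩
  (m % n * o % n + p) % n   ≡⟨ cong (λ z → (z + p) % n) m%n*o%n≡m*o%n ⟩
  (m * o % n + p) % n       ≡⟨ [m%n+o]%n≡[m+o]%n (m * o) p n ⟩
  (m * o + p) % n           ∎
  where
    open ≡-Reasoning
    m%n*o%n≡m*o%n : m % n * o % n ≡ m * o % n
    m%n*o%n≡m*o%n = trans (%-distribˡ-* (m % n) o n)
      (trans (cong (λ z → z * (o % n) % n) (m%n%n≡m%n m n)) (sym (%-distribˡ-* m o n)))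

[n∸k+d]%n≡d∸k : ∀ {n k d} .{{_ : NonZero n}} → k ≤ d → d < n → (n ∸ k + d) % n ≡ d ∸ k
[n∸k+d]%n≡d∸k {n} {k} {d} k≤d d<n = decomposition⇒% (≤-<-trans (m∸n≤m d k) d<n) (begin
  n ∸ k + d            ≡⟨ cong (n ∸ k +_) (sym (m+[n∸m]≡n k≤d)) ⟩
  n ∸ k + (k + (d ∸ k)) ≡⟨ sym (+-assoc (n ∸ k) k (d ∸ k)) ⟩
  n ∸ k + k + (d ∸ k)   ≡⟨ cong (_+ (d ∸ k)) (m∸n+n≡m (≤-trans k≤d (<⇒≤ d<n))) ⟩
  n + (d ∸ k)           ≡⟨ +-comm n (d ∸ k) ⟩
  d ∸ k + n             ≡⟨ cong (d ∸ k +_) (sym (*-identityʳ n)) ⟩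
  d ∸ k + n * 1         ∎)
  where open ≡-Reasoning

m∸[1+d]+d≡m∸1 : ∀ {m d} → suc d ≤ m → m ∸ suc d + d ≡ m ∸ 1
m∸[1+d]+d≡m∸1 {m} {d} 1+d≤m =
  trans (cong pred (trans (sym (+-suc (m ∸ suc d) d)) (m∸n+n≡m 1+d≤m))) (pred[m∸n]≡m∸[1+n] m 0)

m<n⇒m≤n∸1 : ∀ {m n} → m < n → m ≤ n ∸ 1
m<n⇒m≤n∸1 {n = suc n} (s≤s m≤n) = m≤n

≤ᵇ≡true⇒≤ : ∀ {m n} → (m ≤ᵇ n) ≡ true → m ≤ n
≤ᵇ≡true⇒≤ {m} {n} m≤ᵇn = ≤ᵇ⇒≤ m n (subst T (sym m≤ᵇn) _)

≤⇒≤ᵇ≡true : ∀ {m n} → m ≤ n → (m ≤ᵇ n) ≡ true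
≤⇒≤ᵇ≡true m≤n = Equivalence.to T-≡ (≤⇒≤ᵇ m≤n)

record InvertibleMod (n k : ℕ) : Set where
  constructor invertible
  field
    inverse multiple : ℕ
    inverse-eq : inverse * k ≡ 1 + multiple * n

invertible-∣ : ∀ {n k} → InvertibleMod n k → ∀ m → n ∣ m * k → n ∣ m
invertible-∣ {n} {k} (invertible κ q inv) m n∣mk =
  ∣m+n∣m⇒∣n (subst (n ∣_) m*k*κ≡ (∣m⇒∣m*n κ n∣mk)) (n∣m*n (m * q))
  where
    open ≡-Reasoning
    m*k*κ≡ : m * k * κ ≡ m * q * n + m
    m*k*κ≡ = begin
      m * k * κ       ≡⟨ *-rearrange m k κ ⟩
      m * (κ * k)     ≡⟨ cong (m *_) inv ⟩
      m * (1 + q * n) ≡⟨ *-expand m q n ⟩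
      m * q * n + m   ∎
      where
        *-rearrange : ∀ m k κ → m * k * κ ≡ m * (κ * k)
        *-rearrange = solve-∀
        *-expand : ∀ m q n → m * (1 + q * n) ≡ m * q * n + m
        *-expand = solve-∀

n*A≢m*k : ∀ {n k m} A → InvertibleMod n k → 0 < m → m < n → n * A ≢ m * k
n*A≢m*k {n} {k} {m} A inv 0<m m<n nA≡mk = <⇒≱ m<n
  (∣⇒≤ {{>-nonZero 0<m}} (invertible-∣ inv m (divides A (trans (sym nA≡mk) (*-comm n A)))))

residue-surjective : ∀ {n k} .{{_ : NonZero n}} → InvertibleMod n k →
  ∀ {r y} → r ≤ n → y < n → Σ ℕ λ t → t < n × (t * k + r) % n ≡ y
residue-surjective {n} {k} (invertible κ q inv) {r} {y} r≤n y<n = (κ * Y) % n , m%n<n _ n , (begin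
  ((κ * Y) % n * k + r) % n            ≡⟨ [m%n*o+p]%n≡[m*o+p]%n (κ * Y) k r n ⟩
  (κ * Y * k + r) % n                  ≡⟨ cong (λ z → (z + r) % n) (trans (*-rearrange κ Y k) (cong (Y *_) inv)) ⟩
  (Y * (1 + q * n) + r) % n            ≡⟨ cong (_% n) (*-expand y (n ∸ r) q n r) ⟩
  (y + (n ∸ r + r) + Y * q * n) % n    ≡⟨ [m+kn]%n≡m%n _ (Y * q) n ⟩
  (y + (n ∸ r + r)) % n                ≡⟨ cong (λ z → (y + z) % n) (m∸n+n≡m r≤n) ⟩
  (y + n) % n                          ≡⟨ [m+n]%n≡m%n y n ⟩
  y % n                                ≡⟨ m<n⇒m%n≡m y<n ⟩
  y                                    ∎)
  where
    open ≡-Reasoning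
    Y = y + (n ∸ r)
    *-rearrange : ∀ a b c → a * b * c ≡ b * (a * c)
    *-rearrange = solve-∀
    *-expand : ∀ y e q n r → (y + e) * (1 + q * n) + r ≡ y + (e + r) + (y + e) * q * n
    *-expand = solve-∀

module _ {A : Set} {_≼_ : A → A → Set} (≼-refl : ∀ {x} → x ≼ x)
  (≼-trans : ∀ {x y z} → x ≼ y → y ≼ z → x ≼ z) (≼-total : ∀ x y → x ≼ y ⊎ y ≼ x) where

  extremum : (f : ℕ → A) (n : ℕ) → 0 < n → Σ ℕ λ t → t < n × (∀ t′ → t′ < n → f t′ ≼ f t)
  extremum f (suc zero) _ = 0 , z<s , λ { zero _ → ≼-refl ; (suc _) (s≤s ()) }
  extremum f (suc (suc n)) _ with extremum f (suc n) z<s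
  ... | t , t<1+n , best with ≼-total (f t) (f (suc n))
  ... | inj₁ ft≼ = suc n , n<1+n (suc n) , λ t′ t′<2+n → case t′<2+n
    where
      case : ∀ {t′} → t′ < suc (suc n) → f t′ ≼ f (suc n)
      case t′<2+n with m<1+n⇒m<n∨m≡n t′<2+n
      ... | inj₁ t′<1+n = ≼-trans (best _ t′<1+n) ft≼
      ... | inj₂ refl = ≼-refl
  ... | inj₂ ≼ft = t , m<n⇒m<1+n t<1+n , λ t′ t′<2+n → case t′<2+n
    where
      case : ∀ {t′} → t′ < suc (suc n) → f t′ ≼ f t
      case t′<2+n with m<1+n⇒m<n∨m≡n t′<2+n
      ... | inj₁ t′<1+n = best _ t′<1+n
      ... | inj₂ refl = ≼ft

argmax : (f : ℕ → ℕ) (n : ℕ) → 0 < n → Σ ℕ λ t → t < n × (∀ t′ → t′ < n → f t′ ≤ f t)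
argmax = extremum ≤-refl ≤-trans ≤-total

argmin : (f : ℕ → ℕ) (n : ℕ) → 0 < n → Σ ℕ λ t → t < n × (∀ t′ → t′ < n → f t ≤ f t′)
argmin = extremum ≤-refl (λ p q → ≤-trans q p) (λ x y → ≤-total y x)

-- wrap n (i + m) is arcElem n i m by definition, which ties cyclicCount below to arcCount.
wrap : ℕ → ℕ → ℕ
wrap n t = if t <ᵇ n then t else t ∸ n

wrap-< : ∀ {n t} → t < n → wrap n t ≡ t
wrap-< {n} {t} t<n with t <ᵇ n | <ᵇ-reflects-< t n
... | true  | _ = refl
... | false | ofⁿ t≮n = contradiction t<n t≮n

wrap-≥ : ∀ {n t} → n ≤ t → wrap n t ≡ t ∸ n
wrap-≥ {n} {t} n≤t with t <ᵇ n | <ᵇ-reflects-< t n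
... | true  | ofʸ t<n = contradiction n≤t (<⇒≱ t<n)
... | false | _ = refl

wrap-n+ : ∀ n t → wrap n (n + t) ≡ t
wrap-n+ n t = trans (wrap-≥ (m≤m+n n t)) (m+n∸m≡n n t)

wrap<n : ∀ {n t} → t < n + n → wrap n t < n
wrap<n {n} {t} t<2n with t <? n
... | yes t<n = subst (_< n) (sym (wrap-< t<n)) t<n
... | no t≮n = subst (_< n) (sym (wrap-≥ (≮⇒≥ t≮n)))
  (+-cancelʳ-< n (t ∸ n) n (subst (_< n + n) (sym (m∸n+n≡m (≮⇒≥ t≮n))) t<2n))

-- cyclicCount V t counts the i < t with i mod n ∈ V; it is meaningful for t ≤ n + n.
cyclicCount : ∀ {n} → Subset n → ℕ → ℕ
cyclicCount V zero = 0
cyclicCount {n} V (suc t) = cyclicCount V t + indicator (memℕ V (wrap n t))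

cyclicCount-+ : ∀ {n} (V : Subset n) i m → cyclicCount V (i + m) ≡ cyclicCount V i + arcCount V i m
cyclicCount-+ V i zero = trans (cong (cyclicCount V) (+-identityʳ i)) (sym (+-identityʳ _))
cyclicCount-+ V i (suc m) rewrite +-suc i m | cyclicCount-+ V i m =
  +-assoc (cyclicCount V i) (arcCount V i m) _

prefixCount : ∀ {n} → Subset n → ℕ → ℕ
prefixCount V zero = 0
prefixCount V (suc t) = prefixCount V t + indicator (memℕ V t)

prefixCount-∷ : ∀ {n} b (V : Subset n) t → prefixCount (b ∷ V) (suc t) ≡ indicator b + prefixCount V t
prefixCount-∷ b V zero = sym (+-identityʳ (indicator b))
prefixCount-∷ b V (suc t) rewrite prefixCount-∷ b V t = +-assoc (indicator b) (prefixCount V t) _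

prefixCount-size : ∀ {n} (V : Subset n) → prefixCount V n ≡ ∣ V ∣
prefixCount-size [] = refl
prefixCount-size {suc n} (true ∷ V) = trans (prefixCount-∷ true V n) (cong suc (prefixCount-size V))
prefixCount-size {suc n} (false ∷ V) = trans (prefixCount-∷ false V n) (prefixCount-size V)

cyclicCount≡prefixCount : ∀ {n} (V : Subset n) t → t ≤ n → cyclicCount V t ≡ prefixCount V t
cyclicCount≡prefixCount V zero _ = refl
cyclicCount≡prefixCount {n} V (suc t) t<n rewrite wrap-< {n} t<n | cyclicCount≡prefixCount V t (<⇒≤ t<n) = refl

cyclicCount-size : ∀ {n} (V : Subset n) → cyclicCount V n ≡ ∣ V ∣
cyclicCount-size {n} V = trans (cyclicCount≡prefixCount V n ≤-refl) (prefixCount-size V)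

cyclicCount-n+ : ∀ {n} (V : Subset n) t → t ≤ n → cyclicCount V (n + t) ≡ ∣ V ∣ + cyclicCount V t
cyclicCount-n+ {n} V zero _ = trans (cong (cyclicCount V) (+-identityʳ n)) (trans (cyclicCount-size V) (sym (+-identityʳ _)))
cyclicCount-n+ {n} V (suc t) t<n rewrite +-suc n t | wrap-n+ n t | wrap-< {n} t<n | cyclicCount-n+ V t (<⇒≤ t<n) =
  +-assoc ∣ V ∣ (cyclicCount V t) _

memℕ-ext : ∀ {n} (V W : Subset n) → (∀ t → t < n → memℕ V t ≡ memℕ W t) → V ≡ W
memℕ-ext [] [] _ = refl
memℕ-ext (b ∷ V) (c ∷ W) same = cong₂ _∷_ (same 0 z<s) (memℕ-ext V W (λ t t<n → same (suc t) (s<s t<n)))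

memℕ-tabulate : ∀ n (f : ℕ → Bool) t → t < n → memℕ (tabulate {n = n} (λ i → f (toℕ i))) t ≡ f t
memℕ-tabulate (suc n) f zero _ = refl
memℕ-tabulate (suc n) f (suc t) (s≤s t<n) = memℕ-tabulate n (λ x → f (suc x)) t t<n

∈-tabulate⁻ : ∀ {n} {f : Fin n → Bool} {x} → x ∈ tabulate f → f x ≡ true
∈-tabulate⁻ {f = f} {x} x∈ = trans (sym (lookup∘tabulate f x)) ([]=⇒lookup x∈)

∈-tabulate⁺ : ∀ {n} {f : Fin n → Bool} {x} → f x ≡ true → x ∈ tabulate f
∈-tabulate⁺ {f = f} {x} fx = lookup⇒[]= x (tabulate f) (trans (lookup∘tabulate f x) fx)

arc-between : ∀ {n i j} → i < n → j < n → i ≢ j → Σ ℕ λ m → 0 < m × m < n × wrap n (i + m) ≡ j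
arc-between {n} {i} {j} i<n j<n i≢j with <-cmp i j
... | tri≈ _ i≡j _ = contradiction i≡j i≢j
... | tri< i<j _ _ = j ∸ i , m<n⇒0<n∸m i<j , ≤-<-trans (m∸n≤m j i) j<n ,
  trans (cong (wrap n) (m+[n∸m]≡n (<⇒≤ i<j))) (wrap-< j<n)
... | tri> _ _ j<i = j + n ∸ i , m<n⇒0<n∸m i<j+n , j+n∸i<n ,
  trans (cong (wrap n) (trans (m+[n∸m]≡n (<⇒≤ i<j+n)) (+-comm j n))) (wrap-n+ n j)
  where
    i<j+n : i < j + n
    i<j+n = <-≤-trans i<n (m≤n+m n j)
    j+n∸i<n : j + n ∸ i < n
    j+n∸i<n = +-cancelʳ-< i (j + n ∸ i) n (subst (_< n + i) (sym (m∸n+n≡m (<⇒≤ i<j+n)))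
      (subst (_< n + i) (+-comm n j) (+-monoʳ-< n j<i)))

-- Canonical sets

-- t belongs to canonical n k r exactly when ⌊(t k + r) / n⌋ increases from t to t + 1
-- (see quotient-step), so canonical n k r is the k-subset of [n] spread as evenly as
-- possible, rotated by r.
inCanonical : (n k r : ℕ) .{{_ : NonZero n}} → ℕ → Bool
inCanonical n k r t = n ∸ k ≤ᵇ (t * k + r) % n

canonical : (n k r : ℕ) .{{_ : NonZero n}} → Subset n
canonical n k r = tabulate (λ i → inCanonical n k r (toℕ i))

module _ {n : ℕ} (k r : ℕ) .{{_ : NonZero n}} where

  memℕ-canonical : ∀ {t} → t < n → memℕ (canonical n k r) t ≡ inCanonical n k r t
  memℕ-canonical {t} = memℕ-tabulate n (inCanonical n k r) t

  ∈-canonical⁻ : ∀ {x} → x ∈ canonical n k r → n ∸ k ≤ (toℕ x * k + r) % n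
  ∈-canonical⁻ x∈ = ≤ᵇ≡true⇒≤ (∈-tabulate⁻ x∈)

  ∈-canonical⁺ : ∀ {x} → n ∸ k ≤ (toℕ x * k + r) % n → x ∈ canonical n k r
  ∈-canonical⁺ ≤residue = ∈-tabulate⁺ (≤⇒≤ᵇ≡true ≤residue)

  residue-suc : ∀ t → (suc t * k + r) % n ≡ ((t * k + r) % n + k) % n
  residue-suc t = trans (cong (_% n) (suc-distrib t k r)) (sym ([m%n+o]%n≡[m+o]%n (t * k + r) k n))
    where
      suc-distrib : ∀ t k r → suc t * k + r ≡ t * k + r + k
      suc-distrib = solve-∀

  inCanonical-wrap : ∀ {t} → t < n + n → inCanonical n k r (wrap n t) ≡ inCanonical n k r t
  inCanonical-wrap {t} t<2n with t <? n
  ... | yes t<n = cong (inCanonical n k r) (wrap-< t<n)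
  ... | no t≮n = trans (cong (inCanonical n k r) (wrap-≥ n≤t))
    (cong (n ∸ k ≤ᵇ_) (sym (trans (cong (λ z → (z * k + r) % n) (sym (m∸n+n≡m n≤t)))
      (trans (cong (_% n) (unfold (t ∸ n) n k r)) ([m+kn]%n≡m%n ((t ∸ n) * k + r) k n)))))
    where
      n≤t = ≮⇒≥ t≮n
      unfold : ∀ a n k r → (a + n) * k + r ≡ a * k + r + k * n
      unfold = solve-∀

  memℕ-canonical-wrap : ∀ {t} → t < n + n → memℕ (canonical n k r) (wrap n t) ≡ inCanonical n k r t
  memℕ-canonical-wrap t<2n = trans (memℕ-canonical (wrap<n t<2n)) (inCanonical-wrap t<2n)

quotient-+-bounds : ∀ {n x y c A} → IsQuotient n x c → IsQuotient n (x + y) (c + A) →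
  n * A < n + y × y < n * A + n
quotient-+-bounds {n} {x} {y} {c} {A} (bounds nc≤x x<) (bounds ≤x+y x+y<) =
  +-cancelˡ-< (n * c) (n * A) (n + y) (begin-strict
    n * c + n * A  ≡⟨ sym (*-distribˡ-+ n c A) ⟩
    n * (c + A)    ≤⟨ ≤x+y ⟩
    x + y          <⟨ +-monoˡ-< y x< ⟩
    n * c + n + y  ≡⟨ +-assoc (n * c) n y ⟩
    n * c + (n + y) ∎) ,
  +-cancelˡ-< x y (n * A + n) (begin-strict
    x + y              <⟨ x+y< ⟩
    n * (c + A) + n    ≡⟨ cong (_+ n) (*-distribˡ-+ n c A) ⟩
    n * c + n * A + n  ≤⟨ +-monoˡ-≤ n (+-monoˡ-≤ (n * A) nc≤x) ⟩
    x + n * A + n      ≡⟨ +-assoc x (n * A) n ⟩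
    x + (n * A + n)    ∎)
  where open ≤-Reasoning

module Canonical {n k r : ℕ} .{{_ : NonZero n}} (r<n : r < n) (k≤n : k ≤ n) where

  cyclicCount-isQuotient : ∀ t → t ≤ n + n → IsQuotient n (t * k + r) (cyclicCount (canonical n k r) t)
  cyclicCount-isQuotient zero _ = decomposition⇒isQuotient r<n (sym (trans (cong (r +_) (*-zeroʳ n)) (+-identityʳ r)))
  cyclicCount-isQuotient (suc t) t<2n = subst₂ (IsQuotient n) (sym (suc-distrib t k r))
    (cong (λ b → cyclicCount (canonical n k r) t + indicator b) (sym (memℕ-canonical-wrap k r t<2n)))
    (quotient-step k≤n (cyclicCount-isQuotient t (<⇒≤ t<2n)))
    where
      suc-distrib : ∀ t k r → suc t * k + r ≡ t * k + r + k
      suc-distrib = solve-∀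

  size : ∣ canonical n k r ∣ ≡ k
  size = trans (sym (cyclicCount-size (canonical n k r)))
    (isQuotient-unique (cyclicCount-isQuotient n (m≤m+n n n))
      (decomposition⇒isQuotient r<n (+-comm (n * k) r)))

  arcCount-bounds : ∀ {i m} → i < n → m < n →
    n * arcCount (canonical n k r) i m < n + m * k × m * k < n * arcCount (canonical n k r) i m + n
  arcCount-bounds {i} {m} i<n m<n = quotient-+-bounds
    (cyclicCount-isQuotient i (≤-trans (<⇒≤ i<n) (m≤m+n n n)))
    (subst₂ (IsQuotient n) (distrib i m k r) (cyclicCount-+ (canonical n k r) i m)
      (cyclicCount-isQuotient (i + m) (<⇒≤ (+-mono-< i<n m<n))))
    where
      distrib : ∀ i m k r → (i + m) * k + r ≡ i * k + r + m * k
      distrib = solve-∀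

  wellSpread : WellSpread (canonical n k r)
  wellSpread i j m _ m≤n∸1 = m<n+2⇒m≤n+1 (*-cancelˡ-< n _ _ (begin-strict
    n * Aᵢ          <⟨ proj₁ (arcCount-bounds (toℕ<n i) m<n) ⟩
    n + m * k       <⟨ +-monoʳ-< n (proj₂ (arcCount-bounds (toℕ<n j) m<n)) ⟩
    n + (n * Aⱼ + n) ≡⟨ collect n Aⱼ ⟩
    n * (Aⱼ + 2)    ∎))
    where
      open ≤-Reasoning
      Aᵢ = arcCount (canonical n k r) (toℕ i) m
      Aⱼ = arcCount (canonical n k r) (toℕ j) m
      m<n : m < n
      m<n = <-≤-trans (s≤s m≤n∸1) (≤-reflexive (m+[n∸m]≡n (>-nonZero⁻¹ n)))
      collect : ∀ n a → n + (n * a + n) ≡ n * (a + 2)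
      collect = solve-∀
      m<n+2⇒m≤n+1 : ∀ {a b} → a < b + 2 → a ≤ b + 1
      m<n+2⇒m≤n+1 {a} {b} a<b+2 = ≤-pred (subst (a <_) (+-suc b 1) a<b+2)

  noConsecutive : k + k ≤ n → NoConsecutive (canonical n k r)
  noConsecutive 2k≤n i _ (x∈ , x+1∈) = <-irrefl refl (<-≤-trans (≤-<-trans n∸k≤ρ+k∸n ρ+k∸n<k) k≤n∸k)
    where
      x = toℕ i
      ρ = (x * k + r) % n
      n∸k≤ρ : n ∸ k ≤ ρ
      n∸k≤ρ = ≤ᵇ≡true⇒≤ (trans (sym (memℕ-canonical k r (toℕ<n i))) x∈)
      n≤ρ+k : n ≤ ρ + k
      n≤ρ+k = subst (_≤ ρ + k) (m∸n+n≡m k≤n) (+-monoˡ-≤ k n∸k≤ρ)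
      x+1<2n : x + 1 < n + n
      x+1<2n = +-mono-<-≤ (toℕ<n i) (>-nonZero⁻¹ n)
      next-residue : (suc x * k + r) % n ≡ ρ + k ∸ n
      next-residue = trans (residue-suc k r x) (m%n≡m∸n n≤ρ+k (+-mono-<-≤ (m%n<n _ n) k≤n))
      n∸k≤ρ+k∸n : n ∸ k ≤ ρ + k ∸ n
      n∸k≤ρ+k∸n = subst (n ∸ k ≤_) next-residue (≤ᵇ≡true⇒≤ (trans (sym (trans
        (memℕ-canonical-wrap k r x+1<2n) (cong (inCanonical n k r) (+-comm x 1)))) x+1∈))
      ρ+k∸n<k : ρ + k ∸ n < k
      ρ+k∸n<k = +-cancelʳ-< n (ρ + k ∸ n) k (subst (_< k + n) (sym (m∸n+n≡m n≤ρ+k))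
        (subst (ρ + k <_) (+-comm n k) (+-monoˡ-< k (m%n<n (x * k + r) n))))
      k≤n∸k : k ≤ n ∸ k
      k≤n∸k = m+n≤o⇒m≤o∸n k 2k≤n

canonical-noConsecutive : ∀ {n k r} .{{_ : NonZero n}} → r < n → k ≤ n → 2 * k ≤ n ⊎ n ≡ 1 →
  NoConsecutive (canonical n k r)
canonical-noConsecutive {n} {k} r<n k≤n (inj₁ 2k≤n) =
  Canonical.noConsecutive r<n k≤n (subst (_≤ n) (cong (k +_) (+-identityʳ k)) 2k≤n)
canonical-noConsecutive _ _ (inj₂ refl) zero 0≢0 = contradiction refl 0≢0

canonical-isQVertex : ∀ {n k r} .{{_ : NonZero n}} → r < n → k ≤ n → 2 * k ≤ n ⊎ n ≡ 1 →
  IsQVertex n k (canonical n k r)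
canonical-isQVertex r<n k≤n spread =
  Canonical.size r<n k≤n , canonical-noConsecutive r<n k≤n spread , Canonical.wellSpread r<n k≤n

-- Classification of well-spread sets

module Classification {n k : ℕ} .{{_ : NonZero n}} (inv : InvertibleMod n k) (k≤n : k ≤ n)
  (V : Subset n) (size : ∣ V ∣ ≡ k) (spread : WellSpread V) where

  c : ℕ → ℕ
  c = cyclicCount V

  -- Z t = n·c t − t·k + n·k measures how far the count c t of V in [0, t) is ahead of its
  -- fair share t·k/n; it is written so as to stay in ℕ for t ≤ n.
  Z : ℕ → ℕ
  Z t = n * c t + (n ∸ t) * k

  Z+t*k : ∀ {t} → t ≤ n → Z t + t * k ≡ n * c t + n * k
  Z+t*k {t} t≤n = trans (+-assoc (n * c t) _ _)
    (cong (n * c t +_) (trans (sym (*-distribʳ-+ k (n ∸ t) t)) (cong (_* k) (m∸n+n≡m t≤n))))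

  Z-wrap : ∀ {t} → t < n + n → Z (wrap n t) + t * k ≡ n * c t + n * k
  Z-wrap {t} t<2n with t <? n
  ... | yes t<n rewrite wrap-< t<n = Z+t*k (<⇒≤ t<n)
  ... | no t≮n rewrite wrap-≥ {n} (≮⇒≥ t≮n) = begin
    Z j + t * k             ≡⟨ cong (λ z → Z j + z * k) t≡n+j ⟩
    Z j + (n + j) * k       ≡⟨ regroup (Z j) n j k ⟩
    Z j + j * k + n * k     ≡⟨ cong (_+ n * k) (Z+t*k (<⇒≤ j<n)) ⟩
    n * c j + n * k + n * k ≡⟨ collect n (c j) k ⟩
    n * (k + c j) + n * k   ≡⟨ cong (λ z → n * z + n * k) (sym c[n+j]≡k+c[j]) ⟩
    n * c (n + j) + n * k   ≡⟨ cong (λ z → n * c z + n * k) (sym t≡n+j) ⟩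
    n * c t + n * k         ∎
    where
      open ≡-Reasoning
      n≤t = ≮⇒≥ t≮n
      j = t ∸ n
      t≡n+j : t ≡ n + j
      t≡n+j = sym (m+[n∸m]≡n n≤t)
      j<n : j < n
      j<n = m<n+o⇒m∸n<o t n t<2n
      c[n+j]≡k+c[j] : c (n + j) ≡ k + c j
      c[n+j]≡k+c[j] = trans (cyclicCount-n+ V j (<⇒≤ j<n)) (cong (_+ c j) size)
      regroup : ∀ z n j k → z + (n + j) * k ≡ z + j * k + n * k
      regroup = solve-∀
      collect : ∀ n c k → n * c + n * k + n * k ≡ n * (k + c) + n * k
      collect = solve-∀

  Z-arc : ∀ {i m} → i < n → m ≤ n → n * arcCount V i m + Z i ≡ Z (wrap n (i + m)) + m * k
  Z-arc {i} {m} i<n m≤n = +-cancelʳ-≡ (i * k) _ _ (begin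
    n * A + Z i + i * k               ≡⟨ +-assoc (n * A) (Z i) (i * k) ⟩
    n * A + (Z i + i * k)             ≡⟨ cong (n * A +_) (Z+t*k (<⇒≤ i<n)) ⟩
    n * A + (n * c i + n * k)         ≡⟨ collect n A (c i) k ⟩
    n * (c i + A) + n * k             ≡⟨ cong (λ z → n * z + n * k) (sym (cyclicCount-+ V i m)) ⟩
    n * c (i + m) + n * k             ≡⟨ sym (Z-wrap (+-mono-<-≤ i<n m≤n)) ⟩
    Z (wrap n (i + m)) + (i + m) * k  ≡⟨ regroup (Z (wrap n (i + m))) i m k ⟩
    Z (wrap n (i + m)) + m * k + i * k ∎)
    where
      open ≡-Reasoning
      A = arcCount V i m
      collect : ∀ n A c k → n * A + (n * c + n * k) ≡ n * (c + A) + n * k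
      collect = solve-∀
      regroup : ∀ z i m k → z + (i + m) * k ≡ z + m * k + i * k
      regroup = solve-∀

  spread-ℕ : ∀ {i j m} → i < n → j < n → 0 < m → m < n → arcCount V i m ≤ arcCount V j m + 1
  spread-ℕ {i} {j} {m} i<n j<n 0<m m<n = subst₂ (λ x y → arcCount V x m ≤ arcCount V y m + 1)
    (toℕ-fromℕ< i<n) (toℕ-fromℕ< j<n) (spread (fromℕ< i<n) (fromℕ< j<n) m 0<m (m<n⇒m≤n∸1 m<n))

  0<n : 0 < n
  0<n = >-nonZero⁻¹ n

  t₁ t₀ : ℕ
  t₁ = proj₁ (argmax Z n 0<n)
  t₀ = proj₁ (argmin Z n 0<n)

  t₁<n : t₁ < n
  t₁<n = proj₁ (proj₂ (argmax Z n 0<n))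

  t₀<n : t₀ < n
  t₀<n = proj₁ (proj₂ (argmin Z n 0<n))

  Z≤Z-t₁ : ∀ {t} → t < n → Z t ≤ Z t₁
  Z≤Z-t₁ = proj₂ (proj₂ (argmax Z n 0<n)) _

  Z-t₀≤Z : ∀ {t} → t < n → Z t₀ ≤ Z t
  Z-t₀≤Z = proj₂ (proj₂ (argmin Z n 0<n)) _

  -- Compare the arcs of length m starting at t₀ and at t₁; equality is excluded since n ∤ m·k.
  arc⇒Z-max<Z-min+n : ∀ {m} → 0 < m → m < n → wrap n (t₀ + m) ≡ t₁ → Z t₁ < Z t₀ + n
  arc⇒Z-max<Z-min+n {m} 0<m m<n t₀+m≡t₁ = +-cancelʳ-< (m * k) (Z t₁) (Z t₀ + n) (begin-strict
    Z t₁ + m * k       ≡⟨ sym (trans (Z-arc t₀<n (<⇒≤ m<n)) (cong (λ z → Z z + m * k) t₀+m≡t₁)) ⟩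
    n * A₀ + Z t₀      ≤⟨ +-monoˡ-≤ (Z t₀) nA₀≤nA₁+n ⟩
    n * A₁ + n + Z t₀  <⟨ +-monoˡ-< (Z t₀) (+-monoˡ-< n nA₁<mk) ⟩
    m * k + n + Z t₀   ≡⟨ rotate (m * k) n (Z t₀) ⟩
    Z t₀ + n + m * k   ∎)
    where
      open ≤-Reasoning
      A₀ = arcCount V t₀ m
      A₁ = arcCount V t₁ m
      nA₀≤nA₁+n : n * A₀ ≤ n * A₁ + n
      nA₀≤nA₁+n = ≤-trans (*-monoʳ-≤ n (spread-ℕ t₀<n t₁<n 0<m m<n))
        (≤-reflexive (trans (*-distribˡ-+ n A₁ 1) (cong (n * A₁ +_) (*-identityʳ n))))
      nA₁≤mk : n * A₁ ≤ m * k
      nA₁≤mk = +-cancelʳ-≤ (Z t₁) (n * A₁) (m * k) (begin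
        n * A₁ + Z t₁              ≡⟨ Z-arc t₁<n (<⇒≤ m<n) ⟩
        Z (wrap n (t₁ + m)) + m * k ≤⟨ +-monoˡ-≤ (m * k) (Z≤Z-t₁ (wrap<n (+-mono-< t₁<n m<n))) ⟩
        Z t₁ + m * k               ≡⟨ +-comm (Z t₁) (m * k) ⟩
        m * k + Z t₁               ∎)
      nA₁<mk : n * A₁ < m * k
      nA₁<mk = ≤∧≢⇒< nA₁≤mk (n*A≢m*k A₁ inv 0<m m<n)
      rotate : ∀ a b c → a + b + c ≡ c + b + a
      rotate = solve-∀

  Z-max<Z-min+n : Z t₁ < Z t₀ + n
  Z-max<Z-min+n with t₀ ≟ t₁
  ... | yes t₀≡t₁ = subst (λ t → Z t < Z t₀ + n) t₀≡t₁ (m<m+n (Z t₀) 0<n)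
  ... | no t₀≢t₁ with arc-between t₀<n t₁<n t₀≢t₁
  ...   | m , 0<m , m<n , t₀+m≡t₁ = arc⇒Z-max<Z-min+n 0<m m<n t₀+m≡t₁

  Z-n≡Z-0 : Z n ≡ Z 0
  Z-n≡Z-0 = trans (cong₂ _+_ (cong (n *_) (trans (cyclicCount-size V) size)) (cong (_* k) (n∸n≡0 n)))
    (trans (+-identityʳ (n * k)) (cong (_+ n * k) (sym (*-zeroʳ n))))

  Z≤Z-max : ∀ {t} → t ≤ n → Z t ≤ Z t₁
  Z≤Z-max t≤n with m≤n⇒m<n∨m≡n t≤n
  ... | inj₁ t<n = Z≤Z-t₁ t<n
  ... | inj₂ refl = subst (_≤ Z t₁) (sym Z-n≡Z-0) (Z≤Z-t₁ 0<n)

  Z-max<Z+n : ∀ {t} → t ≤ n → Z t₁ < Z t + n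
  Z-max<Z+n t≤n with m≤n⇒m<n∨m≡n t≤n
  ... | inj₁ t<n = <-≤-trans Z-max<Z-min+n (+-monoˡ-≤ n (Z-t₀≤Z t<n))
  ... | inj₂ refl = <-≤-trans Z-max<Z-min+n (+-monoˡ-≤ n (subst (Z t₀ ≤_) (sym Z-n≡Z-0) (Z-t₀≤Z 0<n)))

  -- Since Z oscillates by less than n, c t = ⌊(t k + r) / n⌋ for every t ≤ n.
  r : ℕ
  r = Z t₁ ∸ n * k

  Z-max≡r+nk : Z t₁ ≡ r + n * k
  Z-max≡r+nk = sym (m∸n+n≡m (subst (_≤ Z t₁) (cong (_+ n * k) (*-zeroʳ n)) (Z≤Z-t₁ 0<n)))

  cyclicCount-isQuotient : ∀ {t} → t ≤ n → IsQuotient n (t * k + r) (c t)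
  cyclicCount-isQuotient {t} t≤n = bounds
    (+-cancelʳ-≤ (n * k) (n * c t) (t * k + r) (begin
      n * c t + n * k   ≡⟨ sym (Z+t*k t≤n) ⟩
      Z t + t * k       ≤⟨ +-monoˡ-≤ (t * k) (Z≤Z-max t≤n) ⟩
      Z t₁ + t * k      ≡⟨ cong (_+ t * k) Z-max≡r+nk ⟩
      r + n * k + t * k ≡⟨ rotate r (n * k) (t * k) ⟩
      t * k + r + n * k ∎))
    (+-cancelʳ-< (n * k) (t * k + r) (n * c t + n) (begin-strict
      t * k + r + n * k   ≡⟨ sym (rotate r (n * k) (t * k)) ⟩
      r + n * k + t * k   ≡⟨ cong (_+ t * k) (sym Z-max≡r+nk) ⟩
      Z t₁ + t * k        <⟨ +-monoˡ-< (t * k) (Z-max<Z+n t≤n) ⟩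
      Z t + n + t * k     ≡⟨ swap (Z t) n (t * k) ⟩
      Z t + t * k + n     ≡⟨ cong (_+ n) (Z+t*k t≤n) ⟩
      n * c t + n * k + n ≡⟨ swap (n * c t) (n * k) n ⟩
      n * c t + n + n * k ∎))
    where
      open ≤-Reasoning
      rotate : ∀ a b c → a + b + c ≡ c + a + b
      rotate = solve-∀
      swap : ∀ a b c → a + b + c ≡ a + c + b
      swap = solve-∀

  r<n : r < n
  r<n = subst (r <_) (cong (_+ n) (*-zeroʳ n)) (IsQuotient.upper (cyclicCount-isQuotient z≤n))

  memℕ≡inCanonical : ∀ {t} → t < n → memℕ V t ≡ inCanonical n k r t
  memℕ≡inCanonical {t} t<n = indicator-injective (+-cancelˡ-≡ (c t) _ _ (isQuotient-unique at-suc step))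
    where
      at-suc : IsQuotient n (suc t * k + r) (c t + indicator (memℕ V t))
      at-suc = subst (λ z → IsQuotient n (suc t * k + r) (c t + indicator (memℕ V z))) (wrap-< t<n)
        (cyclicCount-isQuotient t<n)
      suc-distrib : ∀ t k r → t * k + r + k ≡ suc t * k + r
      suc-distrib = solve-∀
      step : IsQuotient n (suc t * k + r) (c t + indicator (inCanonical n k r t))
      step = subst (λ x → IsQuotient n x (c t + indicator (inCanonical n k r t))) (suc-distrib t k r)
        (quotient-step k≤n (cyclicCount-isQuotient (<⇒≤ t<n)))

wellSpread⇒canonical : ∀ {n k} .{{_ : NonZero n}} → InvertibleMod n k → k ≤ n →
  ∀ {V : Subset n} → ∣ V ∣ ≡ k → WellSpread V → Σ ℕ λ r → r < n × V ≡ canonical n k r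
wellSpread⇒canonical {n} {k} inv k≤n {V} size spread = r , r<n ,
  memℕ-ext V (canonical n k r) λ t t<n → trans (memℕ≡inCanonical t<n) (sym (memℕ-canonical k r t<n))
  where open Classification inv k≤n V size spread

-- Circular cliques

Disjoint : ∀ {n} → Subset n → Subset n → Set
Disjoint V W = ∀ x → ¬ (x ∈ V × x ∈ W)

record CircAdj (n k : ℕ) .{{_ : NonZero n}} (x y : ℕ) : Set where
  constructor circAdj
  field
    step : ℕ
    step-lower : k ≤ step
    step-upper : step ≤ n ∸ k
    target : y ≡ (x + step) % n

residue-shift : ∀ {n} .{{_ : NonZero n}} x {r r′} d → (r + d) % n ≡ r′ → (x + r′) % n ≡ ((x + r) % n + d) % n
residue-shift {n} x {r} d refl = begin
  (x + (r + d) % n) % n ≡⟨ [m+o%n]%n≡[m+o]%n x (r + d) n ⟩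
  (x + (r + d)) % n     ≡⟨ cong (_% n) (sym (+-assoc x r d)) ⟩
  (x + r + d) % n       ≡⟨ sym ([m%n+o]%n≡[m+o]%n (x + r) d n) ⟩
  ((x + r) % n + d) % n ∎
  where open ≡-Reasoning

circAdj-shift : ∀ {n k x y} .{{_ : NonZero n}} c → CircAdj n k x y → CircAdj n k ((x + c) % n) ((y + c) % n)
circAdj-shift {n} {x = x} {y} c (circAdj d k≤d d≤n∸k refl) = circAdj d k≤d d≤n∸k (begin
  ((x + d) % n + c) % n ≡⟨ [m%n+o]%n≡[m+o]%n (x + d) c n ⟩
  (x + d + c) % n       ≡⟨ cong (_% n) (+-comm-middle x d c) ⟩
  (x + c + d) % n       ≡⟨ sym ([m%n+o]%n≡[m+o]%n (x + c) d n) ⟩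
  ((x + c) % n + d) % n ∎)
  where
    open ≡-Reasoning
    +-comm-middle : ∀ a b c → a + b + c ≡ a + c + b
    +-comm-middle = solve-∀

module _ {n k : ℕ} .{{_ : NonZero n}} where

  ∈-canonical-at⁺ : ∀ {r t} (t<n : t < n) → n ∸ k ≤ (t * k + r) % n → fromℕ< t<n ∈ canonical n k r
  ∈-canonical-at⁺ {r} t<n =
    ∈-canonical⁺ k r ∘ subst (λ z → n ∸ k ≤ (z * k + r) % n) (sym (toℕ-fromℕ< t<n))

  ∈-canonical-at⁻ : ∀ {r t} (t<n : t < n) → fromℕ< t<n ∈ canonical n k r → n ∸ k ≤ (t * k + r) % n
  ∈-canonical-at⁻ {r} t<n = subst (λ z → n ∸ k ≤ (z * k + r) % n) (toℕ-fromℕ< t<n) ∘ ∈-canonical⁻ k r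

  shifted-witness : InvertibleMod n k → ∀ {r r′ d y} → r < n → (r + d) % n ≡ r′ → y < n →
    Σ ℕ λ t → t < n × (t * k + r) % n ≡ y × (t * k + r′) % n ≡ (y + d) % n
  shifted-witness inv {d = d} r<n r+d≡r′ y<n with residue-surjective inv (<⇒≤ r<n) y<n
  ... | t , t<n , ≡y = t , t<n , ≡y , trans (residue-shift (t * k) d r+d≡r′) (cong (λ z → (z + d) % n) ≡y)

  residue-difference : ∀ {r r′} → r < n → r′ < n → (r + (n + r′ ∸ r) % n) % n ≡ r′
  residue-difference {r} {r′} r<n r′<n = begin
    (r + (n + r′ ∸ r) % n) % n ≡⟨ [m+o%n]%n≡[m+o]%n r (n + r′ ∸ r) n ⟩
    (r + (n + r′ ∸ r)) % n     ≡⟨ cong (_% n) (m+[n∸m]≡n (≤-trans (<⇒≤ r<n) (m≤m+n n r′))) ⟩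
    (n + r′) % n               ≡⟨ cong (_% n) (+-comm n r′) ⟩
    (r′ + n) % n               ≡⟨ [m+n]%n≡m%n r′ n ⟩
    r′ % n                     ≡⟨ m<n⇒m%n≡m r′<n ⟩
    r′                         ∎
    where open ≡-Reasoning

  n∸1<n : n ∸ 1 < n
  n∸1<n = ∸-monoʳ-< {n} {1} {0} z<s (>-nonZero⁻¹ n)

  circAdj⇒disjoint : k ≤ n → ∀ {r r′} → CircAdj n k r r′ → Disjoint (canonical n k r) (canonical n k r′)
  circAdj⇒disjoint k≤n {r} {r′} (circAdj d k≤d d≤n∸k refl) x (x∈ , x∈′) =
    <⇒≱ ρ+d∸n<n∸k (subst (n ∸ k ≤_) (m%n≡m∸n n≤ρ+d ρ+d<2n)
      (subst (n ∸ k ≤_) (residue-shift (toℕ x * k) d refl) (∈-canonical⁻ k _ x∈′)))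
    where
      ρ = (toℕ x * k + r) % n
      n≤ρ+d : n ≤ ρ + d
      n≤ρ+d = subst (_≤ ρ + d) (m∸n+n≡m k≤n) (+-mono-≤ (∈-canonical⁻ k r x∈) k≤d)
      ρ+d<n+[n∸k] : ρ + d < n + (n ∸ k)
      ρ+d<n+[n∸k] = +-mono-<-≤ (m%n<n _ n) d≤n∸k
      ρ+d<2n : ρ + d < n + n
      ρ+d<2n = <-≤-trans ρ+d<n+[n∸k] (+-monoʳ-≤ n (m∸n≤m n k))
      ρ+d∸n<n∸k : ρ + d ∸ n < n ∸ k
      ρ+d∸n<n∸k = +-cancelʳ-< n (ρ + d ∸ n) (n ∸ k)
        (subst₂ _<_ (sym (m∸n+n≡m n≤ρ+d)) (+-comm n (n ∸ k)) ρ+d<n+[n∸k])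

  common-member⇒¬disjoint : InvertibleMod n k → ∀ {r r′ d y} → r < n → (r + d) % n ≡ r′ → y < n →
    n ∸ k ≤ y → n ∸ k ≤ (y + d) % n → ¬ Disjoint (canonical n k r) (canonical n k r′)
  common-member⇒¬disjoint inv r<n r+d≡r′ y<n in-r in-r′ disjoint with shifted-witness inv r<n r+d≡r′ y<n
  ... | t , t<n , ≡y , ≡y+d = disjoint (fromℕ< t<n)
    (∈-canonical-at⁺ t<n (subst (n ∸ k ≤_) (sym ≡y) in-r) ,
     ∈-canonical-at⁺ t<n (subst (n ∸ k ≤_) (sym ≡y+d) in-r′))

  separating-member⇒≢ : InvertibleMod n k → ∀ {r r′ d y} → r < n → (r + d) % n ≡ r′ → y < n →
    n ∸ k ≤ y → (y + d) % n < n ∸ k → canonical n k r ≢ canonical n k r′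
  separating-member⇒≢ inv r<n r+d≡r′ y<n in-r out-r′ same with shifted-witness inv r<n r+d≡r′ y<n
  ... | t , t<n , ≡y , ≡y+d = <⇒≱ out-r′ (subst (n ∸ k ≤_) ≡y+d (∈-canonical-at⁻ t<n
    (subst (fromℕ< t<n ∈_) same (∈-canonical-at⁺ t<n (subst (n ∸ k ≤_) (sym ≡y) in-r)))))

  disjoint⇒circAdj : InvertibleMod n k → 0 < k → k ≤ n → ∀ {r r′} → r < n → r′ < n →
    Disjoint (canonical n k r) (canonical n k r′) → CircAdj n k r r′
  disjoint⇒circAdj inv 0<k k≤n {r} {r′} r<n r′<n disjoint = circAdj d k≤d d≤n∸k (sym r+d≡r′)
    where
      d = (n + r′ ∸ r) % n
      r+d≡r′ : (r + d) % n ≡ r′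
      r+d≡r′ = residue-difference r<n r′<n
      n∸k≤n∸1 : n ∸ k ≤ n ∸ 1
      n∸k≤n∸1 = ∸-monoʳ-≤ n 0<k
      k≤d : k ≤ d
      k≤d with k ≤? d
      ... | yes k≤d = k≤d
      ... | no k≰d = contradiction disjoint (common-member⇒¬disjoint inv r<n r+d≡r′
        (∸-monoʳ-< z<s 1+d≤n) (∸-monoʳ-≤ n (≰⇒> k≰d))
        (subst (n ∸ k ≤_) (sym (trans (cong (_% n) (m∸[1+d]+d≡m∸1 1+d≤n)) (m<n⇒m%n≡m n∸1<n))) n∸k≤n∸1))
        where
          1+d≤n : suc d ≤ n
          1+d≤n = ≤-trans (≰⇒> k≰d) k≤n
      d≤n∸k : d ≤ n ∸ k
      d≤n∸k with d ≤? n ∸ k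
      ... | yes d≤n∸k = d≤n∸k
      ... | no d≰n∸k = contradiction disjoint (common-member⇒¬disjoint inv r<n r+d≡r′ n∸1<n n∸k≤n∸1
        (subst (n ∸ k ≤_) (sym ([n∸k+d]%n≡d∸k (≤-<-trans z≤n (≰⇒> d≰n∸k)) (m%n<n _ n)))
          (m<n⇒m≤n∸1 (≰⇒> d≰n∸k))))

  canonical-injective : InvertibleMod n k → 0 < k → k + k ≤ n →
    ∀ {r r′} → r < n → r′ < n → r ≢ r′ → canonical n k r ≢ canonical n k r′
  canonical-injective inv 0<k 2k≤n {r} {r′} r<n r′<n r≢r′ = separate (d ≤? n ∸ k)
    where
      d = (n + r′ ∸ r) % n
      r+d≡r′ : (r + d) % n ≡ r′
      r+d≡r′ = residue-difference r<n r′<n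
      d<n : d < n
      d<n = m%n<n _ n
      0<d : 0 < d
      0<d = n≢0⇒n>0 λ d≡0 → r≢r′ (trans (sym (m<n⇒m%n≡m r<n))
        (trans (cong (_% n) (sym (trans (cong (r +_) d≡0) (+-identityʳ r)))) r+d≡r′))
      k≤n∸k : k ≤ n ∸ k
      k≤n∸k = m+n≤o⇒m≤o∸n k 2k≤n
      separate : Dec (d ≤ n ∸ k) → canonical n k r ≢ canonical n k r′
      separate (yes d≤n∸k) = separating-member⇒≢ inv r<n r+d≡r′ n∸1<n (∸-monoʳ-≤ n 0<k)
        (subst (_< n ∸ k) (sym ([n∸k+d]%n≡d∸k 0<d d<n)) (<-≤-trans (∸-monoʳ-< z<s 0<d) d≤n∸k))
      separate (no d≰n∸k) = separating-member⇒≢ inv r<n r+d≡r′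
        (∸-monoʳ-< 0<k (≤-trans (m≤m+n k k) 2k≤n)) ≤-refl
        (subst (_< n ∸ k) (sym ([n∸k+d]%n≡d∸k k≤d d<n)) (∸-monoˡ-< d<n k≤d))
        where
          k≤d : k ≤ d
          k≤d = ≤-trans k≤n∸k (<⇒≤ (≰⇒> d≰n∸k))

gap-between : ∀ {a b K N} → a + K ≤ b → b + K ≤ a + N → Σ ℕ λ e → K ≤ e × e ≤ N ∸ K × b ≡ a + e
gap-between {a} {b} {K} {N} a+K≤b b+K≤a+N = b ∸ a , K≤b∸a , b∸a≤N∸K , sym a+[b∸a]≡b
  where
    a+[b∸a]≡b : a + (b ∸ a) ≡ b
    a+[b∸a]≡b = m+[n∸m]≡n (m+n≤o⇒m≤o a a+K≤b)
    K≤b∸a : K ≤ b ∸ a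
    K≤b∸a = m+n≤o⇒m≤o∸n K (subst (_≤ b) (+-comm a K) a+K≤b)
    b∸a≤N∸K : b ∸ a ≤ N ∸ K
    b∸a≤N∸K = m+n≤o⇒m≤o∸n (b ∸ a) (+-cancelˡ-≤ a (b ∸ a + K) N (begin
      a + (b ∸ a + K) ≡⟨ sym (+-assoc a (b ∸ a) K) ⟩
      a + (b ∸ a) + K ≡⟨ cong (_+ K) a+[b∸a]≡b ⟩
      b + K           ≤⟨ b+K≤a+N ⟩
      a + N           ∎))
      where open ≤-Reasoning

-- By h-periodic, h induces a map ℤ/M → ℤ/N; h-gap is the growth condition that makes it a
-- homomorphism of circular cliques K_{M/K} → K_{N/K′} on the points satisfying P.
module CircularMap {M K N K′ : ℕ} .{{_ : NonZero M}} .{{_ : NonZero N}} (h : ℕ → ℕ)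
  (h-periodic : ∀ x → h (x + M) ≡ h x + N) (h< : ∀ {x} → x < M → h x < N)
  (P : ℕ → Set) (P-% : ∀ {z} → P (z % M) → P z)
  (h-gap : ∀ {x g} → P x → K ≤ g → h x + K′ ≤ h (x + g)) where

  h-+* : ∀ x q → h (x + q * M) ≡ h x + q * N
  h-+* x zero = trans (cong h (+-identityʳ x)) (sym (+-identityʳ (h x)))
  h-+* x (suc q) = begin
    h (x + (M + q * M)) ≡⟨ cong h (+-rearrange x M (q * M)) ⟩
    h (x + q * M + M)   ≡⟨ h-periodic (x + q * M) ⟩
    h (x + q * M) + N   ≡⟨ cong (_+ N) (h-+* x q) ⟩
    h x + q * N + N     ≡⟨ +-rearrange′ (h x) (q * N) N ⟩
    h x + (N + q * N)   ∎
    where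
      open ≡-Reasoning
      +-rearrange : ∀ a b c → a + (b + c) ≡ a + c + b
      +-rearrange = solve-∀
      +-rearrange′ : ∀ a b c → a + b + c ≡ a + (c + b)
      +-rearrange′ = solve-∀

  h-% : ∀ z → h z % N ≡ h (z % M)
  h-% z = begin
    h z % N                       ≡⟨ cong (λ w → h w % N) (m≡m%n+[m/n]*n z M) ⟩
    h (z % M + z / M * M) % N     ≡⟨ cong (_% N) (h-+* (z % M) (z / M)) ⟩
    (h (z % M) + z / M * N) % N   ≡⟨ [m+kn]%n≡m%n (h (z % M)) (z / M) N ⟩
    h (z % M) % N                 ≡⟨ m<n⇒m%n≡m (h< (m%n<n z M)) ⟩
    h (z % M)                     ∎
    where open ≡-Reasoning

  -- The upper bound is the lower bound for the complementary step from x + d to x + M.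
  h-step : ∀ {x d} → P x → P (x + d) → K ≤ d → d ≤ M ∸ K →
    Σ ℕ λ e → K′ ≤ e × e ≤ N ∸ K′ × h (x + d) ≡ h x + e
  h-step {x} {d} Px Px+d K≤d d≤M∸K = gap-between (h-gap Px K≤d) (begin
    h (x + d) + K′           ≤⟨ h-gap Px+d K≤M∸d ⟩
    h (x + d + (M ∸ d))      ≡⟨ cong h (trans (+-assoc x d (M ∸ d)) (cong (x +_) (m+[n∸m]≡n d≤M))) ⟩
    h (x + M)                ≡⟨ h-periodic x ⟩
    h x + N                  ∎)
    where
      open ≤-Reasoning
      d≤M : d ≤ M
      d≤M = ≤-trans d≤M∸K (m∸n≤m M K)
      K≤M∸d : K ≤ M ∸ d
      K≤M∸d = m+n≤o⇒m≤o∸n K (subst (_≤ M) (+-comm d K)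
        (m≤o∸n⇒m+n≤o d (≤-trans K≤d d≤M) d≤M∸K))

  h-circAdj : ∀ {x y} → P x → P y → CircAdj M K x y → CircAdj N K′ (h x) (h y)
  h-circAdj {x} {y} Px Py (circAdj d K≤d d≤M∸K refl) with h-step Px (P-% Py) K≤d d≤M∸K
  ... | e , K′≤e , e≤N∸K′ , h[x+d]≡ =
    circAdj e K′≤e e≤N∸K′ (trans (sym (h-% (x + d))) (cong (_% N) h[x+d]≡))

module FloorMap (A M : ℕ) .{{_ : NonZero A}} .{{_ : NonZero M}} where

  floor : ℕ → ℕ
  floor x = x * A / M

  floor-periodic : ∀ x → floor (x + M) ≡ floor x + A
  floor-periodic x = begin
    (x + M) * A / M          ≡⟨ /-congˡ (*-distribʳ-+ A x M) ⟩
    (x * A + M * A) / M      ≡⟨ /-congˡ (cong (x * A +_) (*-comm M A)) ⟩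
    (x * A + A * M) / M      ≡⟨ +-distrib-/-∣ʳ (x * A) (n∣m*n A) ⟩
    x * A / M + A * M / M    ≡⟨ cong (x * A / M +_) (m*n/n≡m A M) ⟩
    x * A / M + A            ∎
    where open ≡-Reasoning

  floor< : ∀ {x} → x < M → floor x < A
  floor< {x} x<M = m<n*o⇒m/o<n (subst (x * A <_) (*-comm M A) (*-monoˡ-< A x<M))

  ≤floor : ∀ {c} x → c * M ≤ x * A → c ≤ floor x
  ≤floor {c} x cM≤xA = subst (_≤ floor x) (m*n/n≡m c M) (/-monoˡ-≤ M cM≤xA)

-- The homomorphisms

complement-inverse : ∀ {n k a b} → a * k + 1 ≡ b * n → a ≤ n → b ≤ k → InvertibleMod n k
complement-inverse {n} {k} {a} {b} ak+1≡bn a≤n b≤k = invertible (n ∸ a) (k ∸ b)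
  (+-cancelʳ-≡ (a * k) _ _ (begin
    (n ∸ a) * k + a * k       ≡⟨ sym (*-distribʳ-+ k (n ∸ a) a) ⟩
    (n ∸ a + a) * k           ≡⟨ cong (_* k) (m∸n+n≡m a≤n) ⟩
    n * k                     ≡⟨ *-comm n k ⟩
    k * n                     ≡⟨ cong (_* n) (sym (m∸n+n≡m b≤k)) ⟩
    (k ∸ b + b) * n           ≡⟨ *-distribʳ-+ n (k ∸ b) b ⟩
    (k ∸ b) * n + b * n       ≡⟨ cong ((k ∸ b) * n +_) (sym ak+1≡bn) ⟩
    (k ∸ b) * n + (a * k + 1) ≡⟨ rotate ((k ∸ b) * n) (a * k) ⟩
    1 + (k ∸ b) * n + a * k   ∎))
  where
    open ≡-Reasoning
    rotate : ∀ x y → x + (y + 1) ≡ 1 + x + y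
    rotate = solve-∀

module Solution {n k a b : ℕ} (0<k : 0 < k) (2k≤n : 2 * k ≤ n) (0<a : 0 < a) (0<b : 0 < b)
  (ak+1≡bn : a * k + 1 ≡ b * n)
  (minimal : (a′ b′ : ℕ) → 0 < a′ → 0 < b′ → a′ * k + 1 ≡ b′ * n → a ≤ a′ × b ≤ b′) where

  k+k≤n : k + k ≤ n
  k+k≤n = subst (_≤ n) (cong (k +_) (+-identityʳ k)) 2k≤n

  k≤n : k ≤ n
  k≤n = ≤-trans (m≤m+n k k) k+k≤n

  1<n : 1 < n
  1<n = ≤-trans (+-mono-≤ 0<k 0<k) k+k≤n

  instance
    n≢0 : NonZero n
    n≢0 = >-nonZero (<-trans z<s 1<n)

    a≢0 : NonZero a
    a≢0 = >-nonZero 0<a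

  -- Otherwise (a ∸ n , b ∸ k) would be a smaller solution.
  a<n : a < n
  a<n with a <? n
  ... | yes a<n = a<n
  ... | no a≮n = contradiction (proj₁ (minimal (a ∸ n) (b ∸ k) 0<a∸n (m<n⇒0<n∸m k<b) smaller))
    (<⇒≱ (∸-monoʳ-< {a} {n} {0} (>-nonZero⁻¹ n) n≤a))
    where
      open ≤-Reasoning
      n≤a = ≮⇒≥ a≮n
      k<b : k < b
      k<b = *-cancelʳ-< n k b (begin-strict
        k * n     ≡⟨ *-comm k n ⟩
        n * k     ≤⟨ *-monoˡ-≤ k n≤a ⟩
        a * k     <⟨ m<m+n (a * k) z<s ⟩
        a * k + 1 ≡⟨ ak+1≡bn ⟩
        b * n     ∎)
      smaller : (a ∸ n) * k + 1 ≡ (b ∸ k) * n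
      smaller = +-cancelʳ-≡ (n * k) _ _ (begin-equality
        (a ∸ n) * k + 1 + n * k ≡⟨ regroup (a ∸ n) k n ⟩
        (a ∸ n + n) * k + 1     ≡⟨ cong (λ z → z * k + 1) (m∸n+n≡m n≤a) ⟩
        a * k + 1               ≡⟨ ak+1≡bn ⟩
        b * n                   ≡⟨ cong (_* n) (sym (m∸n+n≡m (<⇒≤ k<b))) ⟩
        (b ∸ k + k) * n         ≡⟨ expand (b ∸ k) k n ⟩
        (b ∸ k) * n + n * k     ∎)
        where
          regroup : ∀ x k n → x * k + 1 + n * k ≡ (x + n) * k + 1
          regroup = solve-∀
          expand : ∀ x k n → (x + k) * n ≡ x * n + n * k
          expand = solve-∀
      0<a∸n : 0 < a ∸ n
      0<a∸n = n≢0⇒n>0 λ a∸n≡0 → <⇒≱ 1<n (begin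
        n               ≤⟨ m≤n*m n (b ∸ k) {{>-nonZero (m<n⇒0<n∸m k<b)}} ⟩
        (b ∸ k) * n     ≡⟨ sym smaller ⟩
        (a ∸ n) * k + 1 ≡⟨ cong (λ z → z * k + 1) a∸n≡0 ⟩
        1               ∎)

  b≤k : b ≤ k
  b≤k = *-cancelʳ-≤ b k n (begin
    b * n     ≡⟨ sym ak+1≡bn ⟩
    a * k + 1 ≤⟨ +-monoʳ-≤ (a * k) 0<k ⟩
    a * k + k ≡⟨ +-comm (a * k) k ⟩
    suc a * k ≤⟨ *-monoˡ-≤ k a<n ⟩
    n * k     ≡⟨ *-comm n k ⟩
    k * n     ∎)
    where open ≤-Reasoning

  b≤a : b ≤ a
  b≤a = *-cancelʳ-≤ b a n (begin
    b * n     ≡⟨ sym ak+1≡bn ⟩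
    a * k + 1 ≤⟨ +-monoʳ-≤ (a * k) 0<a ⟩
    a * k + a ≡⟨ trans (+-comm (a * k) a) (sym (*-suc a k)) ⟩
    a * suc k ≤⟨ *-monoʳ-≤ a (<-≤-trans (m<m+n k 0<k) k+k≤n) ⟩
    a * n     ∎)
    where open ≤-Reasoning

  2b≤a⊎a≡1 : 2 * b ≤ a ⊎ a ≡ 1
  2b≤a⊎a≡1 with 2 * b ≤? a
  ... | yes 2b≤a = inj₁ 2b≤a
  ... | no 2b≰a = inj₂ (≤-antisym (≤-pred (subst (suc a ≤_) (cong (2 *_) b≡1) a<2b)) 0<a)
    where
      open ≤-Reasoning
      a<2b : suc a ≤ 2 * b
      a<2b = ≰⇒> 2b≰a
      k≤1 : k ≤ 1
      k≤1 = +-cancelˡ-≤ (a * k) k 1 (begin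
        a * k + k   ≡⟨ +-comm (a * k) k ⟩
        suc a * k   ≤⟨ *-monoˡ-≤ k a<2b ⟩
        2 * b * k   ≡⟨ rearrange b k ⟩
        b * (2 * k) ≤⟨ *-monoʳ-≤ b 2k≤n ⟩
        b * n       ≡⟨ sym ak+1≡bn ⟩
        a * k + 1   ∎)
        where
          rearrange : ∀ b k → 2 * b * k ≡ b * (2 * k)
          rearrange = solve-∀
      b≡1 : b ≡ 1
      b≡1 = ≤-antisym (≤-trans b≤k k≤1) 0<b

  invertible-k : InvertibleMod n k
  invertible-k = complement-inverse ak+1≡bn (<⇒≤ a<n) b≤k

  invertible-a : InvertibleMod n a
  invertible-a = complement-inverse (trans (cong (_+ 1) (*-comm k a)) ak+1≡bn) k≤n b≤a

  invertible-b : InvertibleMod a b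
  invertible-b = invertible n k
    (trans (*-comm n b) (trans (sym ak+1≡bn) (trans (+-comm (a * k) 1) (cong suc (*-comm a k)))))

  module Down = FloorMap a n
  module Up = FloorMap n a

  down : ℕ → ℕ
  down = Down.floor

  up : ℕ → ℕ
  up = Up.floor

  -- Since a is invertible modulo n, x a is not a multiple of n, so the remainder absorbs the + 1.
  down-gap : ∀ {x g} → x % n ≢ 0 → k ≤ g → down x + b ≤ down (x + g)
  down-gap {x} {g} x%n≢0 k≤g = Down.≤floor (x + g) (begin
    (down x + b) * n               ≡⟨ *-distribʳ-+ n (down x) b ⟩
    down x * n + b * n             ≡⟨ cong (down x * n +_) (sym ak+1≡bn) ⟩
    down x * n + (a * k + 1)       ≡⟨ rearrange (down x * n) (a * k) ⟩
    down x * n + 1 + a * k         ≤⟨ +-monoˡ-≤ (a * k) (+-monoʳ-≤ (down x * n) 1≤xa%n) ⟩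
    down x * n + x * a % n + a * k ≡⟨ cong (_+ a * k) (trans (+-comm (down x * n) _) (sym (m≡m%n+[m/n]*n (x * a) n))) ⟩
    x * a + a * k                  ≤⟨ +-monoʳ-≤ (x * a) ak≤ga ⟩
    x * a + g * a                  ≡⟨ sym (*-distribʳ-+ a x g) ⟩
    (x + g) * a                    ∎)
    where
      open ≤-Reasoning
      1≤xa%n : 1 ≤ x * a % n
      1≤xa%n = n≢0⇒n>0 λ xa%n≡0 →
        x%n≢0 (n∣m⇒m%n≡0 x n (invertible-∣ invertible-a x (m%n≡0⇒n∣m (x * a) n xa%n≡0)))
      ak≤ga : a * k ≤ g * a
      ak≤ga = ≤-trans (≤-reflexive (*-comm a k)) (*-monoˡ-≤ a k≤g)
      rearrange : ∀ x y → x + (y + 1) ≡ x + 1 + y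
      rearrange = solve-∀

  up-gap : ∀ {s g} → b ≤ g → up s + k ≤ up (s + g)
  up-gap {s} {g} b≤g = Up.≤floor (s + g) (<⇒≤ (begin-strict
    (up s + k) * a   ≡⟨ *-distribʳ-+ a (up s) k ⟩
    up s * a + k * a ≤⟨ +-monoˡ-≤ (k * a) (m/n*n≤m (s * n) a) ⟩
    s * n + k * a    <⟨ +-monoʳ-< (s * n) ka<bn ⟩
    s * n + b * n    ≤⟨ +-monoʳ-≤ (s * n) (*-monoˡ-≤ n b≤g) ⟩
    s * n + g * n    ≡⟨ sym (*-distribʳ-+ n s g) ⟩
    (s + g) * n      ∎))
    where
      open ≤-Reasoning
      ka<bn : k * a < b * n
      ka<bn = subst (k * a <_) (trans (cong (_+ 1) (*-comm k a)) ak+1≡bn) (m<m+n (k * a) z<s)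

  up+1<n : ∀ {s} → s < a → up s + 1 < n
  up+1<n {s} s<a = *-cancelʳ-< a (up s + 1) n (begin-strict
    (up s + 1) * a ≡⟨ trans (*-distribʳ-+ a (up s) 1) (cong (up s * a +_) (*-identityˡ a)) ⟩
    up s * a + a   ≤⟨ +-monoˡ-≤ a (m/n*n≤m (s * n) a) ⟩
    s * n + a      <⟨ +-monoʳ-< (s * n) a<n ⟩
    s * n + n      ≡⟨ +-comm (s * n) n ⟩
    suc s * n      ≤⟨ *-monoˡ-≤ n s<a ⟩
    a * n          ≡⟨ *-comm a n ⟩
    n * a          ∎)
    where open ≤-Reasoning

  module DownMap = CircularMap down Down.floor-periodic Down.floor< (λ x → x % n ≢ 0)
    (λ {z} z%n%n≢0 z%n≡0 → z%n%n≢0 (trans (m%n%n≡m%n z n) z%n≡0)) down-gap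

  module UpMap = CircularMap up Up.floor-periodic Up.floor< (λ _ → ⊤) (λ _ → tt) (λ {s} _ → up-gap {s})

  module Homomorphisms (U : QVertex n k) where

    classify-n : (V : QVertex n k) → Σ ℕ λ r → r < n × proj₁ V ≡ canonical n k r
    classify-n (_ , size , _ , spread) = wellSpread⇒canonical invertible-k k≤n size spread

    classify-a : (W : QVertex a b) → Σ ℕ λ s → s < a × proj₁ W ≡ canonical a b s
    classify-a (_ , size , _ , spread) = wellSpread⇒canonical invertible-b b≤a size spread

    param-n : QVertex n k → ℕ
    param-n V = proj₁ (classify-n V)

    param-n<n : ∀ V → param-n V < n
    param-n<n V = proj₁ (proj₂ (classify-n V))

    canonical-param-n : ∀ V → proj₁ V ≡ canonical n k (param-n V)
    canonical-param-n V = proj₂ (proj₂ (classify-n V))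

    param-a : QVertex a b → ℕ
    param-a W = proj₁ (classify-a W)

    param-a<a : ∀ W → param-a W < a
    param-a<a W = proj₁ (proj₂ (classify-a W))

    canonical-param-a : ∀ W → proj₁ W ≡ canonical a b (param-a W)
    canonical-param-a W = proj₂ (proj₂ (classify-a W))

    adjacent-n : (V W : QVertex n k) → QAdj V W → CircAdj n k (param-n V) (param-n W)
    adjacent-n V W adj = disjoint⇒circAdj invertible-k 0<k k≤n (param-n<n V) (param-n<n W)
      (subst₂ Disjoint (canonical-param-n V) (canonical-param-n W) adj)

    adjacent-a : (W W′ : QVertex a b) → QAdj W W′ → CircAdj a b (param-a W) (param-a W′)
    adjacent-a W W′ adj = disjoint⇒circAdj invertible-b 0<b b≤a (param-a<a W) (param-a<a W′)
      (subst₂ Disjoint (canonical-param-a W) (canonical-param-a W′) adj)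

    r₀ : ℕ
    r₀ = param-n U

    r₀<n : r₀ < n
    r₀<n = param-n<n U

    param-n≢r₀ : (V : QVertex n k) → proj₁ V ≢ proj₁ U → param-n V ≢ r₀
    param-n≢r₀ V V≢U p≡r₀ =
      V≢U (trans (canonical-param-n V) (trans (cong (λ r → canonical n k r) p≡r₀) (sym (canonical-param-n U))))

    shift : ℕ → ℕ
    shift r = (r + (n ∸ r₀)) % n

    shift-nonzero : ∀ {r} → r < n → r ≢ r₀ → shift r % n ≢ 0
    shift-nonzero {r} r<n r≢r₀ shift%n≡0 = r≢r₀ (begin
      r                  ≡⟨ sym (m<n⇒m%n≡m r<n) ⟩
      r % n              ≡⟨ sym ([[m+p]%n+q]%n≡m%n r (m∸n+n≡m (<⇒≤ r₀<n))) ⟩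
      (shift r + r₀) % n ≡⟨ cong (λ z → (z + r₀) % n) (trans (sym (m%n%n≡m%n _ n)) shift%n≡0) ⟩
      r₀ % n             ≡⟨ m<n⇒m%n≡m r₀<n ⟩
      r₀                 ∎)
      where open ≡-Reasoning

    to-vertex : QMinus n k (proj₁ U) → QVertex a b
    to-vertex (V , _) = canonical a b (down (shift (param-n V))) ,
      canonical-isQVertex (Down.floor< (m%n<n _ n)) b≤a 2b≤a⊎a≡1

    to-hom : (V W : QMinus n k (proj₁ U)) → QAdj (proj₁ V) (proj₁ W) → QAdj (to-vertex V) (to-vertex W)
    to-hom (V , V≢U) (W , W≢U) adj = circAdj⇒disjoint b≤a (DownMap.h-circAdj
      (shift-nonzero (param-n<n V) (param-n≢r₀ V V≢U))
      (shift-nonzero (param-n<n W) (param-n≢r₀ W W≢U))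
      (circAdj-shift (n ∸ r₀) (adjacent-n V W adj)))

    from-param : QVertex a b → ℕ
    from-param W = (up (param-a W) + (r₀ + 1)) % n

    from-param≢r₀ : ∀ W → from-param W ≢ r₀
    from-param≢r₀ W from-param≡r₀ = <⇒≢ (m≤n+m 1 (up s)) (sym (begin
      up s + 1                              ≡⟨ sym (m<n⇒m%n≡m (up+1<n (param-a<a W))) ⟩
      (up s + 1) % n                        ≡⟨ sym ([[m+p]%n+q]%n≡m%n (up s + 1) (m+[n∸m]≡n (<⇒≤ r₀<n))) ⟩
      ((up s + 1 + r₀) % n + (n ∸ r₀)) % n ≡⟨ cong (λ z → (z % n + (n ∸ r₀)) % n) (regroup (up s) r₀) ⟩
      (from-param W + (n ∸ r₀)) % n         ≡⟨ cong (λ z → (z + (n ∸ r₀)) % n) from-param≡r₀ ⟩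
      (r₀ + (n ∸ r₀)) % n                   ≡⟨ cong (_% n) (m+[n∸m]≡n (<⇒≤ r₀<n)) ⟩
      n % n                                 ≡⟨ n%n≡0 n ⟩
      0                                     ∎))
      where
        open ≡-Reasoning
        s = param-a W
        regroup : ∀ x r → x + 1 + r ≡ x + (r + 1)
        regroup = solve-∀

    from-vertex : QVertex a b → QMinus n k (proj₁ U)
    from-vertex W = (canonical n k (from-param W) , canonical-isQVertex (m%n<n _ n) k≤n (inj₁ 2k≤n)) ,
      λ same → canonical-injective invertible-k 0<k k+k≤n (m%n<n _ n) r₀<n (from-param≢r₀ W)
        (trans same (canonical-param-n U))

    from-hom : (W W′ : QVertex a b) → QAdj W W′ → QAdj (proj₁ (from-vertex W)) (proj₁ (from-vertex W′))
    from-hom W W′ adj = circAdj⇒disjoint k≤n (circAdj-shift (r₀ + 1) (UpMap.h-circAdj tt tt (adjacent-a W W′ adj)))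

proposition19 : (n k a b : ℕ) → 0 < k → 2 * k ≤ n → gcd n k ≡ 1 →
    0 < a → 0 < b → a * k + 1 ≡ b * n →
    ((a′ b′ : ℕ) → 0 < a′ → 0 < b′ → a′ * k + 1 ≡ b′ * n → a ≤ a′ × b ≤ b′) →
    (U : QVertex n k) →
    HomMinusToQ n k (proj₁ U) a b × HomQToMinus a b n k (proj₁ U)
proposition19 n k a b 0<k 2k≤n _ 0<a 0<b ak+1≡bn minimal U = (to-vertex , to-hom) , (from-vertex , from-hom)
  where open Solution 0<k 2k≤n 0<a 0<b ak+1≡bn minimal
        open Homomorphisms U
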